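{- Let $c>b>a\ge 2$ be pairwise coprime integers, let $k=\lfloor c/b\rfloor$, let $\ell\in\{0,1,\ldots,a-1\}$ with $\ell\equiv cb^{ -1}\pmod a$, and let $q=\lfloor a/(a-\ell)\rfloor$, $r=a-q(a-\ell)$. Suppose $\ell>k$ and $br>cq$, and set $A=br-cq$ and $B=b(a-\ell-r)+c(q+1)$. Then $A\ne B$.
   Context: Reductions modulo $a$ are taken in $\{0,1,\ldots,a-1\}$. -}

module Defs where

open import Data.Nat using (ℕ; _∸_; _<_; NonZero; >-nonZero)
import Data.Nat
import Data.Nat.Properties
open import Data.Nat.Properties using (m<n⇒0<n∸m)

nonZero-∸ : ∀ {ℓ a : ℕ} → ℓ < a → NonZero (a ∸ ℓ)
nonZero-∸ ℓ<a = >-nonZero (m<n⇒0<n∸m ℓ<a)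

nonZero-< : ∀ {a b : ℕ} → a < b → NonZero b
nonZero-< {a} a<b = >-nonZero (Data.Nat.Properties.≤-trans (Data.Nat.s≤s Data.Nat.z≤n) a<b)

nonZero-≤ : ∀ {a : ℕ} → 2 Data.Nat.≤ a → NonZero a
nonZero-≤ 2≤a = >-nonZero (Data.Nat.Properties.≤-trans (Data.Nat.s≤s Data.Nat.z≤n) 2≤a)

-- Put d = a − ℓ, so that q = ⌊a/d⌋ and r = a mod d < d. The equation A = B rearranges to
-- b (2r − d) = c (2q + 1). Its right-hand side is positive, so 2r − d is a positive multiple
-- of c, as c is coprime to b; but 2r − d < d ≤ a < c.
module Submission where

open import Defs
open import Data.Nat using (ℕ; _<_; _≤_; _/_; _%_)
open import Data.Nat.Coprimality using (Coprime)
open import Data.Integer using (ℤ; +_; _+_; _-_; _*_)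
open import Relation.Binary.PropositionalEquality using (_≡_; _≢_)

import Data.Nat as ℕ
import Data.Nat.Properties as ℕ
import Data.Integer as ℤ
import Data.Integer.Properties as ℤ
open import Data.Nat.DivMod using (m%n<n; m%n≡m∸m/n*n; m/n*n≤m)
open import Data.Nat.Divisibility using (divides; ∣⇒≤)
open import Data.Nat.Coprimality using (coprime-divisor) renaming (sym to coprime-sym)
open import Data.Integer.Tactic.RingSolver using (solve-∀)
open import Relation.Binary.PropositionalEquality
  using (sym; trans; cong; cong₂; subst₂; module ≡-Reasoning)
open import Relation.Nullary using (contradiction)

+m-+n≡+[m∸n] : ∀ {m n} → n ≤ m → + m - + n ≡ + (m ℕ.∸ n)
+m-+n≡+[m∸n] {m} {n} n≤m = trans (ℤ.[+m]-[+n]≡m⊖n m n) (ℤ.⊖-≥ n≤m)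

+m-+[m/n]*+n≡+[m%n] : ∀ m n .{{_ : ℕ.NonZero n}} → + m - + (m / n) * + n ≡ + (m % n)
+m-+[m/n]*+n≡+[m%n] m n = begin
  + m - + (m / n) * + n  ≡⟨ cong (+ m -_) (ℤ.pos-* (m / n) n) ⟨
  + m - + (m / n ℕ.* n)  ≡⟨ +m-+n≡+[m∸n] (m/n*n≤m m n) ⟩
  + (m ℕ.∸ m / n ℕ.* n)  ≡⟨ cong +_ (m%n≡m∸m/n*n m n) ⟨
  + (m % n)              ∎
  where open ≡-Reasoning

coprime-*≡*-suc⇒≤ : ∀ {b c m n} → Coprime b c → b ℕ.* m ≡ c ℕ.* ℕ.suc n → c ≤ m
coprime-*≡*-suc⇒≤ {c = ℕ.zero} _ _ = ℕ.z≤n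
coprime-*≡*-suc⇒≤ {b} {ℕ.suc _} {ℕ.zero} _ eq = contradiction (trans (sym (ℕ.*-zeroʳ b)) eq) λ ()
coprime-*≡*-suc⇒≤ {c = c@(ℕ.suc _)} {ℕ.suc _} {n} cop eq =
  ∣⇒≤ (coprime-divisor (coprime-sym cop) (divides (ℕ.suc n) (trans eq (ℕ.*-comm c (ℕ.suc n)))))

b*[r+r]≢b*d+c*[1+n] : ∀ {b c d r n} → Coprime b c → r < d → d < c →
                      b ℕ.* (r ℕ.+ r) ≢ b ℕ.* d ℕ.+ c ℕ.* ℕ.suc n
b*[r+r]≢b*d+c*[1+n] {b} {c} {d} {r} {n} cop r<d d<c eq = ℕ.<-asym d<c c<d
  where
  instance
    d≢0 : ℕ.NonZero d
    d≢0 = ℕ.>-nonZero (ℕ.≤-<-trans ℕ.z≤n r<d)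

  b*[2r∸d]≡c*[1+n] : b ℕ.* (r ℕ.+ r ℕ.∸ d) ≡ c ℕ.* ℕ.suc n
  b*[2r∸d]≡c*[1+n] = begin
    b ℕ.* (r ℕ.+ r ℕ.∸ d)                   ≡⟨ ℕ.*-distribˡ-∸ b (r ℕ.+ r) d ⟩
    b ℕ.* (r ℕ.+ r) ℕ.∸ b ℕ.* d             ≡⟨ cong (ℕ._∸ b ℕ.* d) eq ⟩
    b ℕ.* d ℕ.+ c ℕ.* ℕ.suc n ℕ.∸ b ℕ.* d   ≡⟨ ℕ.m+n∸m≡n (b ℕ.* d) (c ℕ.* ℕ.suc n) ⟩
    c ℕ.* ℕ.suc n                           ∎
    where open ≡-Reasoning

  c<d : c < d
  c<d = ℕ.≤-<-trans (coprime-*≡*-suc⇒≤ cop b*[2r∸d]≡c*[1+n])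
                    (ℕ.m<n+o⇒m∸n<o (r ℕ.+ r) d (ℕ.+-mono-< r<d r<d))

b*r-c*q≡b*[d-r]+c*[1+q]⇒b*[r+r]≡b*d+c*[1+2q] : ∀ (b c d r q : ℕ) →
  + b * + r - + c * + q ≡ + b * (+ d - + r) + + c * + ℕ.suc q →
  b ℕ.* (r ℕ.+ r) ≡ b ℕ.* d ℕ.+ c ℕ.* ℕ.suc (q ℕ.+ q)
b*r-c*q≡b*[d-r]+c*[1+q]⇒b*[r+r]≡b*d+c*[1+2q] b c d r q A≡B = ℤ.+-injective (begin
  + (b ℕ.* (r ℕ.+ r))                    ≡⟨ ℤ.pos-* b (r ℕ.+ r) ⟩
  + b * + (r ℕ.+ r)                      ≡⟨ rearrange (+ b) (+ c) (+ d) (+ r) (+ q) ⟩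
  (A - B) + C                            ≡⟨ cong (_+ C) (ℤ.i≡j⇒i-j≡0 A≡B) ⟩
  ℤ.0ℤ + C                               ≡⟨ ℤ.+-identityˡ C ⟩
  + b * + d + + c * + ℕ.suc (q ℕ.+ q)    ≡⟨ cong₂ _+_ (ℤ.pos-* b d) (ℤ.pos-* c (ℕ.suc (q ℕ.+ q))) ⟨
  + (b ℕ.* d ℕ.+ c ℕ.* ℕ.suc (q ℕ.+ q))  ∎)
  where
  open ≡-Reasoning
  A B C : ℤ
  A = + b * + r - + c * + q
  B = + b * (+ d - + r) + + c * + ℕ.suc q
  C = + b * + d + + c * + ℕ.suc (q ℕ.+ q)

  -- Instantiated at naturals, 1ℤ + + n reduces to + suc n.
  rearrange : ∀ (b c d r q : ℤ) →
              b * (r + r) ≡ (b * r - c * q) - (b * (d - r) + c * (ℤ.1ℤ + q)) + (b * d + c * (ℤ.1ℤ + (q + q)))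
  rearrange = solve-∀

mainTheorem5 : (a b c ℓ : ℕ) → (2≤a : 2 ≤ a) → (a<b : a < b) → b < c →
    Coprime a b → Coprime b c → Coprime a c →
    (ℓ<a : ℓ < a) → _%_ (ℓ Data.Nat.* b) a {{nonZero-≤ 2≤a}} ≡ _%_ c a {{nonZero-≤ 2≤a}} →
    let k = _/_ c b {{nonZero-< a<b}}
        q = _/_ a (a Data.Nat.∸ ℓ) {{nonZero-∸ ℓ<a}}
        r = (+ a) - (+ q) * ((+ a) - (+ ℓ))
        A = (+ b) * r - (+ c) * (+ q)
        B = (+ b) * ((+ a) - (+ ℓ) - r) + (+ c) * (+ (ℕ.suc q))
    in k < ℓ → (+ c) * (+ q) Data.Integer.< (+ b) * r → A ≢ B
mainTheorem5 a b c ℓ _ a<b b<c _ cop-bc _ ℓ<a _ _ _ A≡B =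
  b*[r+r]≢b*d+c*[1+n] cop-bc (m%n<n a d) d<c
    (b*r-c*q≡b*[d-r]+c*[1+q]⇒b*[r+r]≡b*d+c*[1+2q] b c d (a % d) (a / d)
      (subst₂ (λ d′ r′ → + b * r′ - + c * + (a / d) ≡ + b * (d′ - r′) + + c * + ℕ.suc (a / d))
              a-ℓ≡d r≡a%d A≡B))
  where
  d = a ℕ.∸ ℓ
  instance
    d≢0 : ℕ.NonZero d
    d≢0 = nonZero-∸ ℓ<a

  a-ℓ≡d : + a - + ℓ ≡ + d
  a-ℓ≡d = +m-+n≡+[m∸n] (ℕ.<⇒≤ ℓ<a)

  r≡a%d : + a - + (a / d) * (+ a - + ℓ) ≡ + (a % d)
  r≡a%d = trans (cong (λ d′ → + a - + (a / d) * d′) a-ℓ≡d) (+m-+[m/n]*+n≡+[m%n] a d)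

  d<c : d < c
  d<c = ℕ.≤-<-trans (ℕ.m∸n≤m a ℓ) (ℕ.<-trans a<b b<c)
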